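{- Let $\mathcal{S}$ be a blocking semioval in $PG(2,11)$ with $25$ points such that no line meets $\mathcal{S}$ in exactly $10$ points. Then no point of $\mathcal{S}$ lies on more than three $6$-secants to $\mathcal{S}$, and at least four points of $\mathcal{S}$ lie on exactly three $6$-secants to $\mathcal{S}$.
   Context: $PG(2,11)$ is the Desarguesian projective plane over the field with 11 elements. A semioval is a set of points $S$ such that at each point of $S$ there is exactly one tangent line (a line meeting $S$ in exactly one point). A blocking set is a set of points $S$ such that every line meets $S$ in at least one point but $S$ contains no line. A blocking semioval is a set that is both a blocking set and a semioval. For an integer $k$, a $k$-secant to $\mathcal{S}$ is a line meeting $\mathcal{S}$ in exactly $k$ points. -}

module Defs where

open import Data.Nat using (ℕ; zero; suc; _+_; _*_; _%_; _≡ᵇ_)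
open import Data.Fin using (Fin; toℕ)
open import Data.Fin.Base using ()
open import Data.Bool using (Bool; true; false; _∧_)
open import Data.List using (List; []; _∷_; map; filter; length; _++_; concatMap; allFin)
open import Data.Product using (_×_; _,_)
open import Relation.Binary.PropositionalEquality using (_≡_)
open import Data.Bool.Properties using (T?)

-- The field GF(11), elements represented by Fin 11 (arithmetic mod 11).
F : Set
F = Fin 11

-- Points of PG(2,11) in normalized homogeneous coordinates:
--   pA y z = (1 : y : z),  pB z = (0 : 1 : z),  pC = (0 : 0 : 1).
-- Every 1-dimensional subspace of GF(11)^3 has exactly one such representative.
data Point : Set where
  pA : F → F → Point
  pB : F → Point
  pC : Point

-- Lines of PG(2,11): by duality, also given by normalized coordinates [a : b : c],
-- the line being { (x:y:z) | a x + b y + c z = 0 }.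
Line : Set
Line = Point

coords : Point → ℕ × ℕ × ℕ
coords (pA y z) = 1 , toℕ y , toℕ z
coords (pB z)   = 0 , 1 , toℕ z
coords pC       = 0 , 0 , 1

incident : Point → Line → Bool
incident P L with coords P | coords L
... | (x , y , z) | (a , b , c) = ((a * x + b * y + c * z) % 11) ≡ᵇ 0

allPoints : List Point
allPoints = concatMap (λ y → map (pA y) (allFin 11)) (allFin 11)
            ++ map pB (allFin 11) ++ (pC ∷ [])

allLines : List Line
allLines = allPoints

PointSet : Set
PointSet = Point → Bool

count : {A : Set} → (A → Bool) → List A → ℕ
count p xs = length (filter (λ x → T? (p x)) xs)

size : PointSet → ℕ
size S = count S allPoints

meet : PointSet → Line → ℕ
meet S L = count (λ P → S P ∧ incident P L) allPoints

isSecant : ℕ → PointSet → Line → Bool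
isSecant k S L = meet S L ≡ᵇ k

secantsThrough : ℕ → PointSet → Point → ℕ
secantsThrough k S P = count (λ L → incident P L ∧ isSecant k S L) allLines

IsSemioval : PointSet → Set
IsSemioval S = ∀ P → S P ≡ true → secantsThrough 1 S P ≡ 1

IsBlockingSet : PointSet → Set
IsBlockingSet S =
  (∀ L → Data.Nat._≤_ 1 (meet S L)) ×
  (∀ L → (∀ P → incident P L ≡ true → S P ≡ true) → Data.Empty.⊥)
  where import Data.Empty

IsBlockingSemioval : PointSet → Set
IsBlockingSemioval S = IsBlockingSet S × IsSemioval S

-- All counts are double counts of incidences in PG(2,11).  Summing |L ∩ S| over the
-- 12 lines L through a point P gives |S| + 11·[P ∈ S].  Through P ∈ S there is one tangent and
-- every other line meets S at least twice, so the surplus of 4 of each 6-secant through P must fit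
-- into 25 + 11 + 1 − 2·12 = 13: at most three 6-secants.  A line ℓ with k ≥ 7 points of S carries
-- k of the 25 tangents at its points of S, so the other 25 − k tangents pass through the 12 − k
-- points of ℓ off S, at most 11 through each; the pencil count at such a point forces at least
-- k − 3 tangents through it, and only k = 10 survives.  So all secants have 1 to 6 points, and the
-- standard equations Σ tⱼ = 133, Σ j tⱼ = 300, Σ j² tⱼ = 900, t₁ = 25 for the numbers tⱼ of
-- j-secants give t₄ + 3 t₅ + 6 t₆ = 74 (so t₄ ≡ 2 mod 3) and 2 t₆ = 15 + t₃ + t₄, whence t₆ ≥ 9.
-- Finally Σ_{P ∈ S} (6-secants through P) = 6 t₆ ≥ 54, while every point contributes at most 3,
-- so at least 54 − 2·25 = 4 points contribute exactly 3.
module Submission where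

open import Defs
open import Data.Nat using (ℕ; _≤_; _≡ᵇ_)
open import Data.Bool using (Bool; true; _∧_)
open import Data.Product using (_×_)
open import Relation.Binary.PropositionalEquality using (_≡_)
open import Relation.Nullary using (¬_)

open import Data.Bool using (false; not; T)
import Data.Bool.Properties as Bool
open import Data.Empty using (⊥-elim)
open import Data.Fin using (toℕ)
import Data.Fin.Properties as Fin
open import Data.List using (List; []; _∷_; length; lookup; filterᵇ)
open import Data.Nat using (zero; suc; _+_; _*_; _∸_; _%_; _<_; _≤?_; z≤n; s≤s)
open import Data.Nat.DivMod using ([m+kn]%n≡m%n; m%n≤m)
open import Data.Nat.Properties
import Data.Nat.Properties as ℕ
open import Algebra.Properties.CommutativeSemigroup *-commutativeSemigroup using (x∙yz≈y∙xz)
open import Algebra.Properties.Semiring.Sum +-*-semiring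
  using (sum; sum-syntax; sum-cong-≗; sum-replicate-zero; ∑-distrib-+; ∑-comm; *-distribˡ-sum; *-distribʳ-sum)
open import Data.Nat.Tactic.RingSolver using (solve-∀; solve)
open import Data.Product using (_,_; uncurry)
open import Data.Sum using (_⊎_; inj₁; inj₂; [_,_]′)
open import Function using (_∘_; flip; id)
open import Relation.Binary.Definitions using (DecidableEquality)
open import Relation.Binary.PropositionalEquality using (refl; sym; trans; cong; cong₂; subst; subst₂; module ≡-Reasoning)
open import Relation.Nullary.Decidable using (Dec; yes; no; does; dec-true; map′; _×-dec_; toWitness)
open import Relation.Unary using (Pred; Decidable)

⟦_⟧ : Bool → ℕ
⟦ true ⟧ = 1
⟦ false ⟧ = 0

⟦∧⟧ : ∀ a b → ⟦ a ∧ b ⟧ ≡ ⟦ a ⟧ * ⟦ b ⟧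
⟦∧⟧ true b = sym (+-identityʳ ⟦ b ⟧)
⟦∧⟧ false b = refl

⟦⟧≤1 : ∀ b → ⟦ b ⟧ ≤ 1
⟦⟧≤1 true = s≤s z≤n
⟦⟧≤1 false = z≤n

⟦⟧-idem : ∀ b → ⟦ b ⟧ * ⟦ b ⟧ ≡ ⟦ b ⟧
⟦⟧-idem true = refl
⟦⟧-idem false = refl

⟦⟧*-+-⟦not⟧* : ∀ b n → ⟦ b ⟧ * n + ⟦ not b ⟧ * n ≡ n
⟦⟧*-+-⟦not⟧* true n = trans (+-identityʳ (n + 0)) (+-identityʳ n)
⟦⟧*-+-⟦not⟧* false n = +-identityʳ n

not≡true⇒≡false : ∀ {b} → not b ≡ true → b ≡ false
not≡true⇒≡false {false} _ = refl

⟦≡ᵇ⟧*-cong : ∀ m n → ⟦ m ≡ᵇ n ⟧ * m ≡ ⟦ m ≡ᵇ n ⟧ * n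
⟦≡ᵇ⟧*-cong zero zero = refl
⟦≡ᵇ⟧*-cong zero (suc n) = refl
⟦≡ᵇ⟧*-cong (suc m) zero = refl
⟦≡ᵇ⟧*-cong (suc m) (suc n) = begin
  ⟦ m ≡ᵇ n ⟧ * suc m           ≡⟨ *-suc ⟦ m ≡ᵇ n ⟧ m ⟩
  ⟦ m ≡ᵇ n ⟧ + ⟦ m ≡ᵇ n ⟧ * m   ≡⟨ cong (⟦ m ≡ᵇ n ⟧ +_) (⟦≡ᵇ⟧*-cong m n) ⟩
  ⟦ m ≡ᵇ n ⟧ + ⟦ m ≡ᵇ n ⟧ * n   ≡⟨ *-suc ⟦ m ≡ᵇ n ⟧ n ⟨
  ⟦ m ≡ᵇ n ⟧ * suc n           ∎
  where open ≡-Reasoning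

<⇒≡ᵇ-false : ∀ {m n} → m < n → (n ≡ᵇ m) ≡ false
<⇒≡ᵇ-false {zero} (s≤s _) = refl
<⇒≡ᵇ-false {suc m} (s≤s m<n) = <⇒≡ᵇ-false m<n

n≤c+⟦n≡ᵇ1+c⟧ : ∀ n c → n ≤ suc c → n ≤ c + ⟦ n ≡ᵇ suc c ⟧
n≤c+⟦n≡ᵇ1+c⟧ zero c _ = z≤n
n≤c+⟦n≡ᵇ1+c⟧ (suc zero) zero _ = s≤s z≤n
n≤c+⟦n≡ᵇ1+c⟧ (suc (suc n)) zero (s≤s ())
n≤c+⟦n≡ᵇ1+c⟧ (suc n) (suc c) (s≤s n≤c) = s≤s (n≤c+⟦n≡ᵇ1+c⟧ n c n≤c)

2+excess≤ : ∀ {n k} b → 1 ≤ n → (b ≡ true → n ≡ k) → 2 + (k ∸ 2) * ⟦ b ⟧ ≤ n + ⟦ n ≡ᵇ 1 ⟧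
2+excess≤ {n} {k} false 1≤n _ = subst (λ x → 2 + x ≤ n + ⟦ n ≡ᵇ 1 ⟧) (sym (*-zeroʳ (k ∸ 2))) (two≤ 1≤n)
  where
  two≤ : ∀ {n} → 1 ≤ n → 2 ≤ n + ⟦ n ≡ᵇ 1 ⟧
  two≤ {suc zero} _ = ≤-refl
  two≤ {suc (suc n)} _ = s≤s (s≤s z≤n)
2+excess≤ true 1≤n n≡k with refl ← n≡k refl = excess 1≤n
  where
  excess : ∀ {n} → 1 ≤ n → 2 + (n ∸ 2) * 1 ≤ n + ⟦ n ≡ᵇ 1 ⟧
  excess {suc zero} _ = ≤-refl
  excess {suc (suc n)} _ = s≤s (s≤s (≤-reflexive (trans (*-identityʳ n) (sym (+-identityʳ n)))))

module _ {A : Set} where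

  ∑⟨_⟩ : List A → (A → ℕ) → ℕ
  ∑⟨ xs ⟩ f = sum (f ∘ lookup xs)

  ∑-cong : ∀ xs {f g : A → ℕ} → (∀ x → f x ≡ g x) → ∑⟨ xs ⟩ f ≡ ∑⟨ xs ⟩ g
  ∑-cong xs f≗g = sum-cong-≗ (f≗g ∘ lookup xs)

  ∑-+ : ∀ xs (f g : A → ℕ) → ∑⟨ xs ⟩ (λ x → f x + g x) ≡ ∑⟨ xs ⟩ f + ∑⟨ xs ⟩ g
  ∑-+ xs f g = ∑-distrib-+ (f ∘ lookup xs) (g ∘ lookup xs)

  ∑-*ˡ : ∀ xs c (f : A → ℕ) → ∑⟨ xs ⟩ (λ x → c * f x) ≡ c * ∑⟨ xs ⟩ f
  ∑-*ˡ xs c f = sym (*-distribˡ-sum c (f ∘ lookup xs))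

  ∑-*ʳ : ∀ xs c (f : A → ℕ) → ∑⟨ xs ⟩ (λ x → f x * c) ≡ ∑⟨ xs ⟩ f * c
  ∑-*ʳ xs c f = sym (*-distribʳ-sum c (f ∘ lookup xs))

  ∑-weighted-+ : ∀ xs (w f g : A → ℕ) →
                 ∑⟨ xs ⟩ (λ x → w x * (f x + g x)) ≡ ∑⟨ xs ⟩ (λ x → w x * f x) + ∑⟨ xs ⟩ (λ x → w x * g x)
  ∑-weighted-+ xs w f g =
    trans (∑-cong xs (λ x → *-distribˡ-+ (w x) (f x) (g x))) (∑-+ xs (λ x → w x * f x) (λ x → w x * g x))

  ∑-mono-≤ : ∀ xs {f g : A → ℕ} → (∀ x → f x ≤ g x) → ∑⟨ xs ⟩ f ≤ ∑⟨ xs ⟩ g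
  ∑-mono-≤ [] f≤g = z≤n
  ∑-mono-≤ (x ∷ xs) f≤g = +-mono-≤ (f≤g x) (∑-mono-≤ xs f≤g)

  ∑-mono-where : ∀ xs (p : A → Bool) {f g : A → ℕ} → (∀ x → p x ≡ true → f x ≤ g x) →
                 ∑⟨ xs ⟩ (λ x → ⟦ p x ⟧ * f x) ≤ ∑⟨ xs ⟩ (λ x → ⟦ p x ⟧ * g x)
  ∑-mono-where xs p {f} {g} f≤g = ∑-mono-≤ xs pointwise
    where
    pointwise : ∀ x → ⟦ p x ⟧ * f x ≤ ⟦ p x ⟧ * g x
    pointwise x with p x in px
    ... | true = *-monoʳ-≤ 1 (f≤g x px)
    ... | false = z≤n

  count≡∑ : ∀ (p : A → Bool) xs → count p xs ≡ ∑⟨ xs ⟩ (λ x → ⟦ p x ⟧)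
  count≡∑ p [] = refl
  count≡∑ p (x ∷ xs) with p x
  ... | true = cong suc (count≡∑ p xs)
  ... | false = count≡∑ p xs

  count-cong : ∀ {p r : A → Bool} xs → (∀ x → p x ≡ r x) → count p xs ≡ count r xs
  count-cong {p} {r} xs p≗r = begin
    count p xs                ≡⟨ count≡∑ p xs ⟩
    ∑⟨ xs ⟩ (λ x → ⟦ p x ⟧)   ≡⟨ ∑-cong xs (cong ⟦_⟧ ∘ p≗r) ⟩
    ∑⟨ xs ⟩ (λ x → ⟦ r x ⟧)   ≡⟨ count≡∑ r xs ⟨
    count r xs                ∎
    where open ≡-Reasoning

  count-∧ : ∀ (p r : A → Bool) xs → count (λ x → p x ∧ r x) xs ≡ count r (filterᵇ p xs)
  count-∧ p r [] = refl
  count-∧ p r (x ∷ xs) with p x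
  ... | false = count-∧ p r xs
  ... | true with r x
  ...   | true = cong suc (count-∧ p r xs)
  ...   | false = count-∧ p r xs

  ∑-⟦⟧*-const : ∀ xs (p : A → Bool) c → ∑⟨ xs ⟩ (λ x → ⟦ p x ⟧ * c) ≡ count p xs * c
  ∑-⟦⟧*-const xs p c = trans (∑-*ʳ xs c (λ x → ⟦ p x ⟧)) (cong (_* c) (sym (count≡∑ p xs)))

  ∑-kronecker : (_≟_ : DecidableEquality A) → ∀ {x} xs → count (λ y → does (x ≟ y)) xs ≡ 1 →
                (f : A → ℕ) → ∑⟨ xs ⟩ (λ y → ⟦ does (x ≟ y) ⟧ * f y) ≡ f x
  ∑-kronecker _≟_ {x} xs once f = begin
    ∑⟨ xs ⟩ (λ y → ⟦ does (x ≟ y) ⟧ * f y)   ≡⟨ ∑-cong xs δ*f≡f*δ ⟩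
    ∑⟨ xs ⟩ (λ y → f x * ⟦ does (x ≟ y) ⟧)   ≡⟨ ∑-*ˡ xs (f x) (λ y → ⟦ does (x ≟ y) ⟧) ⟩
    f x * ∑⟨ xs ⟩ (λ y → ⟦ does (x ≟ y) ⟧)   ≡⟨ cong (f x *_) (trans (sym (count≡∑ _ xs)) once) ⟩
    f x * 1                                   ≡⟨ *-identityʳ (f x) ⟩
    f x                                       ∎
    where
    open ≡-Reasoning
    δ*f≡f*δ : ∀ y → ⟦ does (x ≟ y) ⟧ * f y ≡ f x * ⟦ does (x ≟ y) ⟧
    δ*f≡f*δ y with x ≟ y
    ... | yes refl = *-comm 1 (f x)
    ... | no _ = sym (*-zeroʳ (f x))

  ∑-≤-by-maxima : ∀ xs (p : A → Bool) (f : A → ℕ) c → (∀ x → p x ≡ true → f x ≤ suc c) →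
                  ∑⟨ xs ⟩ (λ x → ⟦ p x ⟧ * f x) ≤ count p xs * c + count (λ x → p x ∧ (f x ≡ᵇ suc c)) xs
  ∑-≤-by-maxima xs p f c f≤1+c = begin
    ∑⟨ xs ⟩ (λ x → ⟦ p x ⟧ * f x)
      ≤⟨ ∑-mono-≤ xs pointwise ⟩
    ∑⟨ xs ⟩ (λ x → ⟦ p x ⟧ * c + ⟦ p x ∧ (f x ≡ᵇ suc c) ⟧)
      ≡⟨ ∑-+ xs (λ x → ⟦ p x ⟧ * c) (λ x → ⟦ p x ∧ (f x ≡ᵇ suc c) ⟧) ⟩
    ∑⟨ xs ⟩ (λ x → ⟦ p x ⟧ * c) + ∑⟨ xs ⟩ (λ x → ⟦ p x ∧ (f x ≡ᵇ suc c) ⟧)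
      ≡⟨ cong₂ _+_ (∑-⟦⟧*-const xs p c) (sym (count≡∑ _ xs)) ⟩
    count p xs * c + count (λ x → p x ∧ (f x ≡ᵇ suc c)) xs
      ∎
    where
    open ≤-Reasoning
    pointwise : ∀ x → ⟦ p x ⟧ * f x ≤ ⟦ p x ⟧ * c + ⟦ p x ∧ (f x ≡ᵇ suc c) ⟧
    pointwise x with p x in px
    ... | false = z≤n
    ... | true rewrite +-identityʳ (f x) | +-identityʳ c = n≤c+⟦n≡ᵇ1+c⟧ (f x) c (f≤1+c x px)

∑-swap : ∀ {A B : Set} (xs : List A) (ys : List B) (f : A → B → ℕ) →
         ∑⟨ xs ⟩ (λ x → ∑⟨ ys ⟩ (f x)) ≡ ∑⟨ ys ⟩ (λ y → ∑⟨ xs ⟩ (λ x → f x y))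
∑-swap xs ys f = ∑-comm (λ i j → f (lookup xs i) (lookup ys j))

∑-exchange : ∀ {A B : Set} (xs : List A) (ys : List B) (f : A → ℕ) (g : B → ℕ) (h : A → B → ℕ) →
             ∑⟨ ys ⟩ (λ y → g y * ∑⟨ xs ⟩ (λ x → f x * h x y)) ≡ ∑⟨ xs ⟩ (λ x → f x * ∑⟨ ys ⟩ (λ y → g y * h x y))
∑-exchange xs ys f g h = begin
  ∑⟨ ys ⟩ (λ y → g y * ∑⟨ xs ⟩ (λ x → f x * h x y))    ≡⟨ ∑-cong ys (λ y → ∑-*ˡ xs (g y) (λ x → f x * h x y)) ⟨
  ∑⟨ ys ⟩ (λ y → ∑⟨ xs ⟩ (λ x → g y * (f x * h x y)))  ≡⟨ ∑-swap ys xs (λ y x → g y * (f x * h x y)) ⟩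
  ∑⟨ xs ⟩ (λ x → ∑⟨ ys ⟩ (λ y → g y * (f x * h x y)))  ≡⟨ ∑-cong xs (λ x → ∑-cong ys (λ y → x∙yz≈y∙xz (g y) (f x) (h x y))) ⟩
  ∑⟨ xs ⟩ (λ x → ∑⟨ ys ⟩ (λ y → f x * (g y * h x y)))  ≡⟨ ∑-cong xs (λ x → ∑-*ˡ ys (f x) (λ y → g y * h x y)) ⟩
  ∑⟨ xs ⟩ (λ x → f x * ∑⟨ ys ⟩ (λ y → g y * h x y))    ∎
  where open ≡-Reasoning

∑-point-mass : ∀ N n (g : ℕ → ℕ) → n < N → ∑[ j < N ] (⟦ n ≡ᵇ toℕ j ⟧ * g (toℕ j)) ≡ g n
∑-point-mass (suc N) zero g _ = trans (cong₂ _+_ (+-identityʳ (g 0)) (sum-replicate-zero N)) (+-identityʳ (g 0))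
∑-point-mass (suc N) (suc n) g (s≤s n<N) = ∑-point-mass N n (g ∘ suc) n<N

∑-by-value : ∀ {A : Set} xs (h : A → ℕ) (g : ℕ → ℕ) N → (∀ x → h x < N) →
             ∑⟨ xs ⟩ (g ∘ h) ≡ ∑[ j < N ] (count (λ x → h x ≡ᵇ toℕ j) xs * g (toℕ j))
∑-by-value xs h g N h<N = begin
  ∑⟨ xs ⟩ (g ∘ h)
    ≡⟨ ∑-cong xs (λ x → ∑-point-mass N (h x) g (h<N x)) ⟨
  ∑⟨ xs ⟩ (λ x → ∑[ j < N ] (⟦ h x ≡ᵇ toℕ j ⟧ * g (toℕ j)))
    ≡⟨ ∑-comm {length xs} {N} (λ i j → ⟦ h (lookup xs i) ≡ᵇ toℕ j ⟧ * g (toℕ j)) ⟩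
  ∑[ j < N ] ∑⟨ xs ⟩ (λ x → ⟦ h x ≡ᵇ toℕ j ⟧ * g (toℕ j))
    ≡⟨ sum-cong-≗ {N} (λ j → ∑-*ʳ xs (g (toℕ j)) (λ x → ⟦ h x ≡ᵇ toℕ j ⟧)) ⟩
  ∑[ j < N ] (∑⟨ xs ⟩ (λ x → ⟦ h x ≡ᵇ toℕ j ⟧) * g (toℕ j))
    ≡⟨ sum-cong-≗ {N} (λ j → cong (_* g (toℕ j)) (count≡∑ (λ x → h x ≡ᵇ toℕ j) xs)) ⟨
  ∑[ j < N ] (count (λ x → h x ≡ᵇ toℕ j) xs * g (toℕ j))
    ∎
  where open ≡-Reasoning

-- Finite projective planes

-- For P ≢ Q, lines-through-both says that P and Q span exactly one line; for P ≡ Q, that P lies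
-- on order + 1 lines.  points-on-both is the dual statement.
record ProjectivePlane : Set₁ where
  field
    𝒫 ℒ : Set
    points : List 𝒫
    lines : List ℒ
    _on_ : 𝒫 → ℒ → Bool
    order : ℕ
    _≟ᴾ_ : DecidableEquality 𝒫
    _≟ᴸ_ : DecidableEquality ℒ
    points-listed-once : ∀ P → count (λ Q → does (P ≟ᴾ Q)) points ≡ 1
    lines-listed-once : ∀ L → count (λ M → does (L ≟ᴸ M)) lines ≡ 1
    lines-through-both : ∀ P Q → count (λ L → P on L ∧ Q on L) lines ≡ 1 + order * ⟦ does (P ≟ᴾ Q) ⟧
    points-on-both : ∀ L M → count (λ P → P on L ∧ P on M) points ≡ 1 + order * ⟦ does (L ≟ᴸ M) ⟧

dual : ProjectivePlane → ProjectivePlane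
dual Π = record
  { 𝒫 = ℒ ; ℒ = 𝒫 ; points = lines ; lines = points ; _on_ = flip _on_ ; order = order
  ; _≟ᴾ_ = _≟ᴸ_ ; _≟ᴸ_ = _≟ᴾ_
  ; points-listed-once = lines-listed-once ; lines-listed-once = points-listed-once
  ; lines-through-both = points-on-both ; points-on-both = lines-through-both
  }
  where open ProjectivePlane Π

module Pencils (Π : ProjectivePlane) where
  open ProjectivePlane Π

  ∑ᴾ : (𝒫 → ℕ) → ℕ
  ∑ᴾ = ∑⟨ points ⟩

  ∑ᴸ : (ℒ → ℕ) → ℕ
  ∑ᴸ = ∑⟨ lines ⟩

  ∑-lines-through-both : ∀ P Q → ∑ᴸ (λ L → ⟦ P on L ⟧ * ⟦ Q on L ⟧) ≡ 1 + order * ⟦ does (P ≟ᴾ Q) ⟧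
  ∑-lines-through-both P Q = begin
    ∑ᴸ (λ L → ⟦ P on L ⟧ * ⟦ Q on L ⟧)   ≡⟨ ∑-cong lines (λ L → ⟦∧⟧ (P on L) (Q on L)) ⟨
    ∑ᴸ (λ L → ⟦ P on L ∧ Q on L ⟧)       ≡⟨ count≡∑ (λ L → P on L ∧ Q on L) lines ⟨
    count (λ L → P on L ∧ Q on L) lines  ≡⟨ lines-through-both P Q ⟩
    1 + order * ⟦ does (P ≟ᴾ Q) ⟧        ∎
    where open ≡-Reasoning

  lines-through : ∀ P → ∑ᴸ (λ L → ⟦ P on L ⟧) ≡ 1 + order
  lines-through P = begin
    ∑ᴸ (λ L → ⟦ P on L ⟧)                ≡⟨ ∑-cong lines (λ L → ⟦⟧-idem (P on L)) ⟨
    ∑ᴸ (λ L → ⟦ P on L ⟧ * ⟦ P on L ⟧)   ≡⟨ ∑-lines-through-both P P ⟩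
    1 + order * ⟦ does (P ≟ᴾ P) ⟧        ≡⟨ cong (λ b → 1 + order * ⟦ b ⟧) (dec-true (P ≟ᴾ P) refl) ⟩
    1 + order * 1                        ≡⟨ cong (1 +_) (*-identityʳ order) ⟩
    1 + order                            ∎
    where open ≡-Reasoning

  ∑-on-kronecker : ∀ Q ℓ → ∑ᴸ (λ L → ⟦ Q on L ⟧ * ⟦ does (ℓ ≟ᴸ L) ⟧) ≡ ⟦ Q on ℓ ⟧
  ∑-on-kronecker Q ℓ =
    trans (∑-cong lines (λ L → *-comm ⟦ Q on L ⟧ ⟦ does (ℓ ≟ᴸ L) ⟧))
          (∑-kronecker _≟ᴸ_ lines (lines-listed-once ℓ) (λ L → ⟦ Q on L ⟧))

  ∑-pencil : ∀ (f : 𝒫 → ℕ) P → ∑ᴸ (λ L → ⟦ P on L ⟧ * ∑ᴾ (λ Q → f Q * ⟦ Q on L ⟧)) ≡ ∑ᴾ f + order * f P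
  ∑-pencil f P = begin
    ∑ᴸ (λ L → ⟦ P on L ⟧ * ∑ᴾ (λ Q → f Q * ⟦ Q on L ⟧))
      ≡⟨ ∑-exchange points lines f (λ L → ⟦ P on L ⟧) (λ Q L → ⟦ Q on L ⟧) ⟩
    ∑ᴾ (λ Q → f Q * ∑ᴸ (λ L → ⟦ P on L ⟧ * ⟦ Q on L ⟧))
      ≡⟨ ∑-cong points (λ Q → cong (f Q *_) (∑-lines-through-both P Q)) ⟩
    ∑ᴾ (λ Q → f Q * (1 + order * δ Q))
      ≡⟨ ∑-cong points (λ Q → expand (f Q) order (δ Q)) ⟩
    ∑ᴾ (λ Q → f Q + order * (δ Q * f Q))
      ≡⟨ ∑-+ points f (λ Q → order * (δ Q * f Q)) ⟩
    ∑ᴾ f + ∑ᴾ (λ Q → order * (δ Q * f Q))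
      ≡⟨ cong (∑ᴾ f +_) (∑-*ˡ points order (λ Q → δ Q * f Q)) ⟩
    ∑ᴾ f + order * ∑ᴾ (λ Q → δ Q * f Q)
      ≡⟨ cong (λ s → ∑ᴾ f + order * s) (∑-kronecker _≟ᴾ_ points (points-listed-once P) f) ⟩
    ∑ᴾ f + order * f P
      ∎
    where
    open ≡-Reasoning
    δ : 𝒫 → ℕ
    δ Q = ⟦ does (P ≟ᴾ Q) ⟧
    expand : ∀ a q d → a * (1 + q * d) ≡ a + q * (d * a)
    expand = solve-∀

module PointSets (Π : ProjectivePlane) where
  open ProjectivePlane Π
  open Pencils Π
  private module Dual = Pencils (dual Π)

  ∣_∣ : (𝒫 → Bool) → ℕ
  ∣ S ∣ = count S points

  ∣_∩_∣ : (𝒫 → Bool) → ℒ → ℕ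
  ∣ S ∩ L ∣ = count (λ P → S P ∧ P on L) points

  secantsAt : ℕ → (𝒫 → Bool) → 𝒫 → ℕ
  secantsAt k S P = count (λ L → P on L ∧ (∣ S ∩ L ∣ ≡ᵇ k)) lines

  secants : ℕ → (𝒫 → Bool) → ℕ
  secants k S = count (λ L → ∣ S ∩ L ∣ ≡ᵇ k) lines

  ∣∩∣≡∑ : ∀ S L → ∣ S ∩ L ∣ ≡ ∑ᴾ (λ Q → ⟦ S Q ⟧ * ⟦ Q on L ⟧)
  ∣∩∣≡∑ S L = trans (count≡∑ (λ Q → S Q ∧ Q on L) points) (∑-cong points (λ Q → ⟦∧⟧ (S Q) (Q on L)))

  module _ (S : 𝒫 → Bool) where

    secantsAt≡∑ : ∀ k P → secantsAt k S P ≡ ∑ᴸ (λ L → ⟦ P on L ⟧ * ⟦ ∣ S ∩ L ∣ ≡ᵇ k ⟧)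
    secantsAt≡∑ k P = trans (count≡∑ _ lines) (∑-cong lines (λ L → ⟦∧⟧ (P on L) (∣ S ∩ L ∣ ≡ᵇ k)))

    ∑-meet-through : ∀ P → ∑ᴸ (λ L → ⟦ P on L ⟧ * ∣ S ∩ L ∣) ≡ ∣ S ∣ + order * ⟦ S P ⟧
    ∑-meet-through P = begin
      ∑ᴸ (λ L → ⟦ P on L ⟧ * ∣ S ∩ L ∣)                         ≡⟨ ∑-cong lines (λ L → cong (⟦ P on L ⟧ *_) (∣∩∣≡∑ S L)) ⟩
      ∑ᴸ (λ L → ⟦ P on L ⟧ * ∑ᴾ (λ Q → ⟦ S Q ⟧ * ⟦ Q on L ⟧))  ≡⟨ ∑-pencil (λ Q → ⟦ S Q ⟧) P ⟩
      ∑ᴾ (λ Q → ⟦ S Q ⟧) + order * ⟦ S P ⟧                      ≡⟨ cong (_+ order * ⟦ S P ⟧) (count≡∑ S points) ⟨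
      ∣ S ∣ + order * ⟦ S P ⟧                                   ∎
      where open ≡-Reasoning

    ∑-secantsAt-on : ∀ k ℓ → ∑ᴾ (λ Q → ⟦ Q on ℓ ⟧ * secantsAt k S Q) ≡ secants k S + order * ⟦ ∣ S ∩ ℓ ∣ ≡ᵇ k ⟧
    ∑-secantsAt-on k ℓ = begin
      ∑ᴾ (λ Q → ⟦ Q on ℓ ⟧ * secantsAt k S Q)
        ≡⟨ ∑-cong points (λ Q → cong (⟦ Q on ℓ ⟧ *_) (trans (secantsAt≡∑ k Q) (∑-cong lines (λ L → *-comm ⟦ Q on L ⟧ (e L))))) ⟩
      ∑ᴾ (λ Q → ⟦ Q on ℓ ⟧ * ∑ᴸ (λ L → e L * ⟦ Q on L ⟧))
        ≡⟨ Dual.∑-pencil e ℓ ⟩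
      ∑ᴸ e + order * e ℓ
        ≡⟨ cong (_+ order * e ℓ) (count≡∑ _ lines) ⟨
      secants k S + order * e ℓ
        ∎
      where
      open ≡-Reasoning
      e : ℒ → ℕ
      e L = ⟦ ∣ S ∩ L ∣ ≡ᵇ k ⟧

    ∑-secantsAt-over : ∀ k → ∑ᴾ (λ P → ⟦ S P ⟧ * secantsAt k S P) ≡ secants k S * k
    ∑-secantsAt-over k = begin
      ∑ᴾ (λ P → ⟦ S P ⟧ * secantsAt k S P)
        ≡⟨ ∑-cong points (λ P → cong (⟦ S P ⟧ *_) (trans (secantsAt≡∑ k P) (∑-cong lines (λ L → *-comm ⟦ P on L ⟧ (e L))))) ⟩
      ∑ᴾ (λ P → ⟦ S P ⟧ * ∑ᴸ (λ L → e L * ⟦ P on L ⟧))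
        ≡⟨ ∑-exchange points lines (λ P → ⟦ S P ⟧) e (λ P L → ⟦ P on L ⟧) ⟨
      ∑ᴸ (λ L → e L * ∑ᴾ (λ P → ⟦ S P ⟧ * ⟦ P on L ⟧))
        ≡⟨ ∑-cong lines (λ L → trans (cong (e L *_) (sym (∣∩∣≡∑ S L))) (⟦≡ᵇ⟧*-cong ∣ S ∩ L ∣ k)) ⟩
      ∑ᴸ (λ L → e L * k)
        ≡⟨ ∑-*ʳ lines k e ⟩
      ∑ᴸ e * k
        ≡⟨ cong (_* k) (count≡∑ _ lines) ⟨
      secants k S * k
        ∎
      where
      open ≡-Reasoning
      e : ℒ → ℕ
      e L = ⟦ ∣ S ∩ L ∣ ≡ᵇ k ⟧

    ∑-meet : ∑ᴸ ∣ S ∩_∣ ≡ ∣ S ∣ * (1 + order)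
    ∑-meet = begin
      ∑ᴸ ∣ S ∩_∣                                   ≡⟨ ∑-cong lines (∣∩∣≡∑ S) ⟩
      ∑ᴸ (λ L → ∑ᴾ (λ Q → ⟦ S Q ⟧ * ⟦ Q on L ⟧))   ≡⟨ ∑-swap lines points (λ L Q → ⟦ S Q ⟧ * ⟦ Q on L ⟧) ⟩
      ∑ᴾ (λ Q → ∑ᴸ (λ L → ⟦ S Q ⟧ * ⟦ Q on L ⟧))   ≡⟨ ∑-cong points (λ Q → ∑-*ˡ lines ⟦ S Q ⟧ (λ L → ⟦ Q on L ⟧)) ⟩
      ∑ᴾ (λ Q → ⟦ S Q ⟧ * ∑ᴸ (λ L → ⟦ Q on L ⟧))   ≡⟨ ∑-cong points (λ Q → cong (⟦ S Q ⟧ *_) (lines-through Q)) ⟩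
      ∑ᴾ (λ Q → ⟦ S Q ⟧ * (1 + order))             ≡⟨ ∑-⟦⟧*-const points S (1 + order) ⟩
      ∣ S ∣ * (1 + order)                          ∎
      where open ≡-Reasoning

    ∑-meet² : ∑ᴸ (λ L → ∣ S ∩ L ∣ * ∣ S ∩ L ∣) ≡ ∣ S ∣ * (∣ S ∣ + order)
    ∑-meet² = begin
      ∑ᴸ (λ L → ∣ S ∩ L ∣ * ∣ S ∩ L ∣)
        ≡⟨ ∑-cong lines (λ L → cong (∣ S ∩ L ∣ *_) (∣∩∣≡∑ S L)) ⟩
      ∑ᴸ (λ L → ∣ S ∩ L ∣ * ∑ᴾ (λ Q → ⟦ S Q ⟧ * ⟦ Q on L ⟧))
        ≡⟨ ∑-exchange points lines (λ Q → ⟦ S Q ⟧) ∣ S ∩_∣ (λ Q L → ⟦ Q on L ⟧) ⟩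
      ∑ᴾ (λ Q → ⟦ S Q ⟧ * ∑ᴸ (λ L → ∣ S ∩ L ∣ * ⟦ Q on L ⟧))
        ≡⟨ ∑-cong points (λ Q → cong (⟦ S Q ⟧ *_) (pencil Q)) ⟩
      ∑ᴾ (λ Q → ⟦ S Q ⟧ * (∣ S ∣ + order * ⟦ S Q ⟧))
        ≡⟨ ∑-cong points (λ Q → idem (S Q)) ⟩
      ∑ᴾ (λ Q → ⟦ S Q ⟧ * (∣ S ∣ + order))
        ≡⟨ ∑-⟦⟧*-const points S (∣ S ∣ + order) ⟩
      ∣ S ∣ * (∣ S ∣ + order)
        ∎
      where
      open ≡-Reasoning
      pencil : ∀ Q → ∑ᴸ (λ L → ∣ S ∩ L ∣ * ⟦ Q on L ⟧) ≡ ∣ S ∣ + order * ⟦ S Q ⟧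
      pencil Q = trans (∑-cong lines (λ L → *-comm ∣ S ∩ L ∣ ⟦ Q on L ⟧)) (∑-meet-through Q)
      idem : ∀ b → ⟦ b ⟧ * (∣ S ∣ + order * ⟦ b ⟧) ≡ ⟦ b ⟧ * (∣ S ∣ + order)
      idem true = cong (λ x → (∣ S ∣ + x) + 0) (*-identityʳ order)
      idem false = refl

    meet-+-meet-complement : ∀ ℓ → ∣ S ∩ ℓ ∣ + ∣ (not ∘ S) ∩ ℓ ∣ ≡ 1 + order
    meet-+-meet-complement ℓ = begin
      ∣ S ∩ ℓ ∣ + ∣ (not ∘ S) ∩ ℓ ∣
        ≡⟨ cong₂ _+_ (∣∩∣≡∑ S ℓ) (∣∩∣≡∑ (not ∘ S) ℓ) ⟩
      ∑ᴾ (λ Q → ⟦ S Q ⟧ * ⟦ Q on ℓ ⟧) + ∑ᴾ (λ Q → ⟦ not (S Q) ⟧ * ⟦ Q on ℓ ⟧)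
        ≡⟨ ∑-+ points (λ Q → ⟦ S Q ⟧ * ⟦ Q on ℓ ⟧) (λ Q → ⟦ not (S Q) ⟧ * ⟦ Q on ℓ ⟧) ⟨
      ∑ᴾ (λ Q → ⟦ S Q ⟧ * ⟦ Q on ℓ ⟧ + ⟦ not (S Q) ⟧ * ⟦ Q on ℓ ⟧)
        ≡⟨ ∑-cong points (λ Q → ⟦⟧*-+-⟦not⟧* (S Q) ⟦ Q on ℓ ⟧) ⟩
      ∑ᴾ (λ Q → ⟦ Q on ℓ ⟧)
        ≡⟨ Dual.lines-through ℓ ⟩
      1 + order
        ∎
      where open ≡-Reasoning

    tangentsAt≤order : ∀ ℓ Q → 2 ≤ ∣ S ∩ ℓ ∣ → Q on ℓ ≡ true → secantsAt 1 S Q ≤ order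
    tangentsAt≤order ℓ Q 2≤∣S∩ℓ∣ Q∈ℓ = ≤-pred (begin
      suc (secantsAt 1 S Q)
        ≡⟨ +-comm 1 (secantsAt 1 S Q) ⟩
      secantsAt 1 S Q + 1
        ≡⟨ cong₂ _+_ (secantsAt≡∑ 1 Q) (trans (cong ⟦_⟧ (sym Q∈ℓ)) (sym (∑-on-kronecker Q ℓ))) ⟩
      ∑ᴸ (λ L → ⟦ Q on L ⟧ * e L) + ∑ᴸ (λ L → ⟦ Q on L ⟧ * δ L)
        ≡⟨ ∑-weighted-+ lines (λ L → ⟦ Q on L ⟧) e δ ⟨
      ∑ᴸ (λ L → ⟦ Q on L ⟧ * (e L + δ L))
        ≤⟨ ∑-mono-≤ lines (λ L → *-monoʳ-≤ ⟦ Q on L ⟧ (e+δ≤1 L)) ⟩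
      ∑ᴸ (λ L → ⟦ Q on L ⟧ * 1)
        ≡⟨ ∑-cong lines (λ L → *-identityʳ ⟦ Q on L ⟧) ⟩
      ∑ᴸ (λ L → ⟦ Q on L ⟧)
        ≡⟨ lines-through Q ⟩
      suc order
        ∎)
      where
      open ≤-Reasoning
      e δ : ℒ → ℕ
      e L = ⟦ ∣ S ∩ L ∣ ≡ᵇ 1 ⟧
      δ L = ⟦ does (ℓ ≟ᴸ L) ⟧
      e+δ≤1 : ∀ L → e L + δ L ≤ 1
      e+δ≤1 L with ℓ ≟ᴸ L
      ... | yes refl = subst (λ b → ⟦ b ⟧ + 1 ≤ 1) (sym (<⇒≡ᵇ-false 2≤∣S∩ℓ∣)) ≤-refl
      ... | no _ = subst (_≤ 1) (sym (+-identityʳ (e L))) (⟦⟧≤1 (∣ S ∩ L ∣ ≡ᵇ 1))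

    module BlockingSemioval (blocking : ∀ L → 1 ≤ ∣ S ∩ L ∣) (unique-tangent : ∀ P → S P ≡ true → secantsAt 1 S P ≡ 1) where

      tangents≡size : secants 1 S ≡ ∣ S ∣
      tangents≡size = begin
        secants 1 S                            ≡⟨ *-identityʳ (secants 1 S) ⟨
        secants 1 S * 1                        ≡⟨ ∑-secantsAt-over 1 ⟨
        ∑ᴾ (λ P → ⟦ S P ⟧ * secantsAt 1 S P)   ≡⟨ ∑-cong points one-tangent ⟩
        ∑ᴾ (λ P → ⟦ S P ⟧)                     ≡⟨ count≡∑ S points ⟨
        ∣ S ∣                                  ∎
        where
        open ≡-Reasoning
        one-tangent : ∀ P → ⟦ S P ⟧ * secantsAt 1 S P ≡ ⟦ S P ⟧
        one-tangent P with S P in P∈S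
        ... | true = trans (+-identityʳ _) (unique-tangent P P∈S)
        ... | false = refl

      -- Every line L through P has |L ∩ S| + [L is a tangent] ≥ 2, and ≥ k when b L (then |L ∩ S| = k).
      pencil-bound : ∀ P (b : ℒ → Bool) k → (∀ L → b L ≡ true → ∣ S ∩ L ∣ ≡ k) →
                     (1 + order) * 2 + (k ∸ 2) * count (λ L → P on L ∧ b L) lines ≤ ∣ S ∣ + order * ⟦ S P ⟧ + secantsAt 1 S P
      pencil-bound P b k b⇒k = begin
        (1 + order) * 2 + (k ∸ 2) * count (λ L → P on L ∧ b L) lines
          ≡⟨ lower ⟨
        ∑ᴸ (λ L → ⟦ P on L ⟧ * (2 + (k ∸ 2) * ⟦ b L ⟧))
          ≤⟨ ∑-mono-≤ lines (λ L → *-monoʳ-≤ ⟦ P on L ⟧ (2+excess≤ (b L) (blocking L) (b⇒k L))) ⟩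
        ∑ᴸ (λ L → ⟦ P on L ⟧ * (∣ S ∩ L ∣ + ⟦ ∣ S ∩ L ∣ ≡ᵇ 1 ⟧))
          ≡⟨ ∑-weighted-+ lines (λ L → ⟦ P on L ⟧) ∣ S ∩_∣ (λ L → ⟦ ∣ S ∩ L ∣ ≡ᵇ 1 ⟧) ⟩
        ∑ᴸ (λ L → ⟦ P on L ⟧ * ∣ S ∩ L ∣) + ∑ᴸ (λ L → ⟦ P on L ⟧ * ⟦ ∣ S ∩ L ∣ ≡ᵇ 1 ⟧)
          ≡⟨ cong₂ _+_ (∑-meet-through P) (sym (secantsAt≡∑ 1 P)) ⟩
        ∣ S ∣ + order * ⟦ S P ⟧ + secantsAt 1 S P
          ∎
        where
        open ≤-Reasoning
        lower : ∑ᴸ (λ L → ⟦ P on L ⟧ * (2 + (k ∸ 2) * ⟦ b L ⟧)) ≡ (1 + order) * 2 + (k ∸ 2) * count (λ L → P on L ∧ b L) lines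
        lower = begin-equality
          ∑ᴸ (λ L → ⟦ P on L ⟧ * (2 + (k ∸ 2) * ⟦ b L ⟧))
            ≡⟨ ∑-weighted-+ lines (λ L → ⟦ P on L ⟧) (λ _ → 2) (λ L → (k ∸ 2) * ⟦ b L ⟧) ⟩
          ∑ᴸ (λ L → ⟦ P on L ⟧ * 2) + ∑ᴸ (λ L → ⟦ P on L ⟧ * ((k ∸ 2) * ⟦ b L ⟧))
            ≡⟨ cong₂ _+_ (∑-*ʳ lines 2 (λ L → ⟦ P on L ⟧)) (∑-cong lines (λ L → x∙yz≈y∙xz ⟦ P on L ⟧ (k ∸ 2) ⟦ b L ⟧)) ⟩
          ∑ᴸ (λ L → ⟦ P on L ⟧) * 2 + ∑ᴸ (λ L → (k ∸ 2) * (⟦ P on L ⟧ * ⟦ b L ⟧))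
            ≡⟨ cong₂ _+_ (cong (_* 2) (lines-through P)) (∑-*ˡ lines (k ∸ 2) (λ L → ⟦ P on L ⟧ * ⟦ b L ⟧)) ⟩
          (1 + order) * 2 + (k ∸ 2) * ∑ᴸ (λ L → ⟦ P on L ⟧ * ⟦ b L ⟧)
            ≡⟨ cong (λ x → (1 + order) * 2 + (k ∸ 2) * x) (∑-cong lines (λ L → ⟦∧⟧ (P on L) (b L))) ⟨
          (1 + order) * 2 + (k ∸ 2) * ∑ᴸ (λ L → ⟦ P on L ∧ b L ⟧)
            ≡⟨ cong (λ x → (1 + order) * 2 + (k ∸ 2) * x) (count≡∑ (λ L → P on L ∧ b L) lines) ⟨
          (1 + order) * 2 + (k ∸ 2) * count (λ L → P on L ∧ b L) lines
            ∎

      secantsAt-bound : ∀ k P → S P ≡ true → (1 + order) * 2 + (k ∸ 2) * secantsAt k S P ≤ ∣ S ∣ + order + 1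
      secantsAt-bound k P P∈S =
        subst ((1 + order) * 2 + (k ∸ 2) * secantsAt k S P ≤_) rhs
              (pencil-bound P (λ L → ∣ S ∩ L ∣ ≡ᵇ k) k (λ L eq → ≡ᵇ⇒≡ _ k (subst T (sym eq) _)))
        where
        rhs : ∣ S ∣ + order * ⟦ S P ⟧ + secantsAt 1 S P ≡ ∣ S ∣ + order + 1
        rhs = cong₂ (λ x y → ∣ S ∣ + x + y) (trans (cong (λ b → order * ⟦ b ⟧) P∈S) (*-identityʳ order)) (unique-tangent P P∈S)

      pencil-off-S : ∀ ℓ Q → Q on ℓ ≡ true → S Q ≡ false → (1 + order) * 2 + (∣ S ∩ ℓ ∣ ∸ 2) ≤ ∣ S ∣ + secantsAt 1 S Q
      pencil-off-S ℓ Q Q∈ℓ Q∉S = subst₂ _≤_ lhs rhs (pencil-bound Q (λ L → does (ℓ ≟ᴸ L)) ∣ S ∩ ℓ ∣ meet-ℓ)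
        where
        meet-ℓ : ∀ L → does (ℓ ≟ᴸ L) ≡ true → ∣ S ∩ L ∣ ≡ ∣ S ∩ ℓ ∣
        meet-ℓ L _ with ℓ ≟ᴸ L
        ... | yes refl = refl
        one-line : count (λ L → Q on L ∧ does (ℓ ≟ᴸ L)) lines ≡ 1
        one-line = begin
          count (λ L → Q on L ∧ does (ℓ ≟ᴸ L)) lines   ≡⟨ count≡∑ (λ L → Q on L ∧ does (ℓ ≟ᴸ L)) lines ⟩
          ∑ᴸ (λ L → ⟦ Q on L ∧ does (ℓ ≟ᴸ L) ⟧)        ≡⟨ ∑-cong lines (λ L → ⟦∧⟧ (Q on L) (does (ℓ ≟ᴸ L))) ⟩
          ∑ᴸ (λ L → ⟦ Q on L ⟧ * ⟦ does (ℓ ≟ᴸ L) ⟧)    ≡⟨ ∑-on-kronecker Q ℓ ⟩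
          ⟦ Q on ℓ ⟧                                   ≡⟨ cong ⟦_⟧ Q∈ℓ ⟩
          1                                            ∎
          where open ≡-Reasoning
        lhs : (1 + order) * 2 + (∣ S ∩ ℓ ∣ ∸ 2) * count (λ L → Q on L ∧ does (ℓ ≟ᴸ L)) lines ≡ (1 + order) * 2 + (∣ S ∩ ℓ ∣ ∸ 2)
        lhs = cong ((1 + order) * 2 +_) (trans (cong ((∣ S ∩ ℓ ∣ ∸ 2) *_) one-line) (*-identityʳ _))
        rhs : ∣ S ∣ + order * ⟦ S Q ⟧ + secantsAt 1 S Q ≡ ∣ S ∣ + secantsAt 1 S Q
        rhs = cong (_+ secantsAt 1 S Q) (trans (cong (λ b → ∣ S ∣ + order * ⟦ b ⟧) Q∉S) (trans (cong (∣ S ∣ +_) (*-zeroʳ order)) (+-identityʳ ∣ S ∣)))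

      tangentsOff : ℒ → ℕ
      tangentsOff ℓ = ∑ᴾ (λ Q → ⟦ not (S Q) ∧ Q on ℓ ⟧ * secantsAt 1 S Q)

      meet-+-tangentsOff : ∀ ℓ → 2 ≤ ∣ S ∩ ℓ ∣ → ∣ S ∩ ℓ ∣ + tangentsOff ℓ ≡ ∣ S ∣
      meet-+-tangentsOff ℓ 2≤∣S∩ℓ∣ = begin
        ∣ S ∩ ℓ ∣ + tangentsOff ℓ
          ≡⟨ cong (_+ tangentsOff ℓ) (∣∩∣≡∑ S ℓ) ⟩
        ∑ᴾ (λ Q → ⟦ S Q ⟧ * ⟦ Q on ℓ ⟧) + tangentsOff ℓ
          ≡⟨ ∑-+ points (λ Q → ⟦ S Q ⟧ * ⟦ Q on ℓ ⟧) (λ Q → ⟦ not (S Q) ∧ Q on ℓ ⟧ * τ Q) ⟨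
        ∑ᴾ (λ Q → ⟦ S Q ⟧ * ⟦ Q on ℓ ⟧ + ⟦ not (S Q) ∧ Q on ℓ ⟧ * τ Q)
          ≡⟨ ∑-cong points split ⟩
        ∑ᴾ (λ Q → ⟦ Q on ℓ ⟧ * τ Q)
          ≡⟨ ∑-secantsAt-on 1 ℓ ⟩
        secants 1 S + order * ⟦ ∣ S ∩ ℓ ∣ ≡ᵇ 1 ⟧
          ≡⟨ cong₂ (λ t b → t + order * ⟦ b ⟧) tangents≡size (<⇒≡ᵇ-false 2≤∣S∩ℓ∣) ⟩
        ∣ S ∣ + order * 0
          ≡⟨ cong (∣ S ∣ +_) (*-zeroʳ order) ⟩
        ∣ S ∣ + 0
          ≡⟨ +-identityʳ ∣ S ∣ ⟩
        ∣ S ∣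
          ∎
        where
        open ≡-Reasoning
        τ : 𝒫 → ℕ
        τ = secantsAt 1 S
        split : ∀ Q → ⟦ S Q ⟧ * ⟦ Q on ℓ ⟧ + ⟦ not (S Q) ∧ Q on ℓ ⟧ * τ Q ≡ ⟦ Q on ℓ ⟧ * τ Q
        split Q with S Q in Q∈S
        ... | true = trans (+-identityʳ _) (trans (+-identityʳ _)
                       (sym (trans (cong (⟦ Q on ℓ ⟧ *_) (unique-tangent Q Q∈S)) (*-identityʳ _))))
        ... | false = refl

      tangentsOff-≤ : ∀ ℓ → 2 ≤ ∣ S ∩ ℓ ∣ → tangentsOff ℓ ≤ ∣ (not ∘ S) ∩ ℓ ∣ * order
      tangentsOff-≤ ℓ 2≤∣S∩ℓ∣ = begin
        tangentsOff ℓ                                ≤⟨ ∑-mono-where points off-S-on-ℓ bound ⟩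
        ∑ᴾ (λ Q → ⟦ off-S-on-ℓ Q ⟧ * order)          ≡⟨ ∑-⟦⟧*-const points off-S-on-ℓ order ⟩
        ∣ (not ∘ S) ∩ ℓ ∣ * order                    ∎
        where
        open ≤-Reasoning
        off-S-on-ℓ : 𝒫 → Bool
        off-S-on-ℓ Q = not (S Q) ∧ Q on ℓ
        bound : ∀ Q → off-S-on-ℓ Q ≡ true → secantsAt 1 S Q ≤ order
        bound Q eq = tangentsAt≤order ℓ Q 2≤∣S∩ℓ∣ (Bool.∧-conicalʳ (not (S Q)) (Q on ℓ) eq)

      tangentsOff-≥ : ∀ ℓ → ∣ (not ∘ S) ∩ ℓ ∣ * ((1 + order) * 2 + (∣ S ∩ ℓ ∣ ∸ 2)) ≤ ∣ (not ∘ S) ∩ ℓ ∣ * ∣ S ∣ + tangentsOff ℓ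
      tangentsOff-≥ ℓ = begin
        ∣ (not ∘ S) ∩ ℓ ∣ * c
          ≡⟨ ∑-⟦⟧*-const points off-S-on-ℓ c ⟨
        ∑ᴾ (λ Q → ⟦ off-S-on-ℓ Q ⟧ * c)
          ≤⟨ ∑-mono-where points off-S-on-ℓ bound ⟩
        ∑ᴾ (λ Q → ⟦ off-S-on-ℓ Q ⟧ * (∣ S ∣ + secantsAt 1 S Q))
          ≡⟨ ∑-weighted-+ points (λ Q → ⟦ off-S-on-ℓ Q ⟧) (λ _ → ∣ S ∣) (secantsAt 1 S) ⟩
        ∑ᴾ (λ Q → ⟦ off-S-on-ℓ Q ⟧ * ∣ S ∣) + tangentsOff ℓ
          ≡⟨ cong (_+ tangentsOff ℓ) (∑-⟦⟧*-const points off-S-on-ℓ ∣ S ∣) ⟩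
        ∣ (not ∘ S) ∩ ℓ ∣ * ∣ S ∣ + tangentsOff ℓ
          ∎
        where
        open ≤-Reasoning
        c : ℕ
        c = (1 + order) * 2 + (∣ S ∩ ℓ ∣ ∸ 2)
        off-S-on-ℓ : 𝒫 → Bool
        off-S-on-ℓ Q = not (S Q) ∧ Q on ℓ
        bound : ∀ Q → off-S-on-ℓ Q ≡ true → c ≤ ∣ S ∣ + secantsAt 1 S Q
        bound Q eq = pencil-off-S ℓ Q (Bool.∧-conicalʳ (not (S Q)) (Q on ℓ) eq)
                                      (not≡true⇒≡false (Bool.∧-conicalˡ (not (S Q)) (Q on ℓ) eq))

-- The plane PG(2,11)

_≟ₚ_ : DecidableEquality Point
pA a b ≟ₚ pA c d = map′ (uncurry (cong₂ pA)) (λ { refl → refl , refl }) ((a Fin.≟ c) ×-dec (b Fin.≟ d))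
pB a ≟ₚ pB c = map′ (cong pB) (λ { refl → refl }) (a Fin.≟ c)
pC ≟ₚ pC = yes refl
pA _ _ ≟ₚ pB _ = no λ ()
pA _ _ ≟ₚ pC = no λ ()
pB _ ≟ₚ pA _ _ = no λ ()
pB _ ≟ₚ pC = no λ ()
pC ≟ₚ pA _ _ = no λ ()
pC ≟ₚ pB _ = no λ ()

∀-point? : ∀ {ℓ} {Q : Pred Point ℓ} → Decidable Q → Dec (∀ P → Q P)
∀-point? Q? = map′ (λ { ((a , b) , c) → λ { (pA y z) → a y z ; (pB z) → b z ; pC → c } })
                   (λ ∀Q → ((λ y z → ∀Q (pA y z)) , (λ z → ∀Q (pB z))) , ∀Q pC)
                   ((Fin.all? (λ y → Fin.all? λ z → Q? (pA y z)) ×-dec Fin.all? (λ z → Q? (pB z))) ×-dec Q? pC)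

incident-sym : ∀ P L → incident P L ≡ incident L P
incident-sym = toWitness {a? = ∀-point? λ P → ∀-point? λ L → incident P L Bool.≟ incident L P} _

points-listed-once : ∀ P → count (λ Q → does (P ≟ₚ Q)) allPoints ≡ 1
points-listed-once = toWitness {a? = ∀-point? λ P → count (λ Q → does (P ≟ₚ Q)) allPoints ℕ.≟ 1} _

-- The lines through P are passed as an argument so that they are computed once per point, not once per pair.
lines-through-both : ∀ P Q → count (incident Q) (filterᵇ (incident P) allLines) ≡ 1 + 11 * ⟦ does (P ≟ₚ Q) ⟧
lines-through-both = toWitness {a? = ∀-point? λ P → pencil? P (filterᵇ (incident P) allLines)} _
  where
  pencil? : ∀ P ls → Dec (∀ Q → count (incident Q) ls ≡ 1 + 11 * ⟦ does (P ≟ₚ Q) ⟧)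
  pencil? P ls = ∀-point? λ Q → count (incident Q) ls ℕ.≟ 1 + 11 * ⟦ does (P ≟ₚ Q) ⟧

PG[2,11] : ProjectivePlane
PG[2,11] = record
  { 𝒫 = Point ; ℒ = Line ; points = allPoints ; lines = allLines ; _on_ = incident ; order = 11
  ; _≟ᴾ_ = _≟ₚ_ ; _≟ᴸ_ = _≟ₚ_
  ; points-listed-once = points-listed-once ; lines-listed-once = points-listed-once
  ; lines-through-both = λ P Q → trans (count-∧ (incident P) (incident Q) allLines) (lines-through-both P Q)
  ; points-on-both = λ L M → trans (count-cong allPoints (λ P → cong₂ _∧_ (incident-sym P L) (incident-sym P M)))
                                   (trans (count-∧ (incident L) (incident M) allLines) (lines-through-both L M))
  }

24+4x≤37⇒x≤3 : ∀ x → 24 + 4 * x ≤ 37 → x ≤ 3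
24+4x≤37⇒x≤3 x h with x ≤? 3
... | yes x≤3 = x≤3
... | no x≰3 = ⊥-elim (≤⇒≤ᵇ (≤-trans (+-monoʳ-≤ 24 (*-monoʳ-≤ 4 (≰⇒> x≰3))) h))

long-secant-arith : ∀ {k u T} → u + k ≡ 12 → k + T ≡ 25 → T ≤ u * 11 → u * (24 + (k ∸ 2)) ≤ u * 25 + T → k ≤ 6 ⊎ k ≡ 10
long-secant-arith {u = 0} refl refl T≤ _ = ⊥-elim (≤⇒≤ᵇ T≤)
long-secant-arith {u = 1} refl refl T≤ _ = ⊥-elim (≤⇒≤ᵇ T≤)
long-secant-arith {u = 2} refl refl _ _ = inj₂ refl
long-secant-arith {u = 3} refl refl _ T≥ = ⊥-elim (≤⇒≤ᵇ T≥)
long-secant-arith {u = 4} refl refl _ T≥ = ⊥-elim (≤⇒≤ᵇ T≥)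
long-secant-arith {u = 5} refl refl _ T≥ = ⊥-elim (≤⇒≤ᵇ T≥)
long-secant-arith {k} {u = suc (suc (suc (suc (suc (suc v)))))} u+k≡12 _ _ _ =
  inj₁ (subst (k ≤_) (+-cancelˡ-≡ 6 (v + k) 6 u+k≡12) (m≤n+m k v))

-- identity₁ and identity₂ are Σⱼ (j − 2)(j − 3) tⱼ and Σⱼ (j − 2)(j − 5) tⱼ expanded, with the
-- negative terms moved across so that no subtraction occurs.
six-secants≥9 : ∀ t₁ t₂ t₃ t₄ t₅ t₆ → t₁ ≡ 25
  → t₁ * 1 + t₂ * 1 + t₃ * 1 + t₄ * 1 + t₅ * 1 + t₆ * 1 ≡ 133
  → t₁ * 1 + t₂ * 2 + t₃ * 3 + t₄ * 4 + t₅ * 5 + t₆ * 6 ≡ 300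
  → t₁ * 1 + t₂ * 4 + t₃ * 9 + t₄ * 16 + t₅ * 25 + t₆ * 36 ≡ 900
  → 9 ≤ t₆
six-secants≥9 .25 t₂ t₃ t₄ t₅ t₆ refl σ₀≡133 σ₁≡300 σ₂≡900 =
  *-cancelˡ-< 4 8 t₆ (+-cancelˡ-< 2200 (4 * 8) (4 * t₆) (begin-strict
    2200 + 4 * 8            <⟨ m≤m+n 2233 1 ⟩
    2230 + 2 * 2            ≤⟨ +-monoʳ-≤ 2230 (*-monoʳ-≤ 2 (≤-trans 2≤t₄ (m≤n+m t₄ t₃))) ⟩
    2230 + 2 * (t₃ + t₄)    ≡⟨ weights₂₅ ⟨
    2200 + 4 * t₆           ∎))
  where
  open ≤-Reasoning
  identity₁ : ∀ t₁ t₂ t₃ t₄ t₅ t₆ →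
    5 * (t₁ * 1 + t₂ * 2 + t₃ * 3 + t₄ * 4 + t₅ * 5 + t₆ * 6) + 2 * (t₁ + (t₄ + (t₅ + 2 * t₆) * 3))
      ≡ (t₁ * 1 + t₂ * 4 + t₃ * 9 + t₄ * 16 + t₅ * 25 + t₆ * 36)
        + 6 * (t₁ * 1 + t₂ * 1 + t₃ * 1 + t₄ * 1 + t₅ * 1 + t₆ * 1)
  identity₁ = solve-∀
  identity₂ : ∀ t₁ t₂ t₃ t₄ t₅ t₆ →
    7 * (t₁ * 1 + t₂ * 2 + t₃ * 3 + t₄ * 4 + t₅ * 5 + t₆ * 6) + 4 * t₁ + 4 * t₆
      ≡ (t₁ * 1 + t₂ * 4 + t₃ * 9 + t₄ * 16 + t₅ * 25 + t₆ * 36)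
        + 10 * (t₁ * 1 + t₂ * 1 + t₃ * 1 + t₄ * 1 + t₅ * 1 + t₆ * 1) + 2 * (t₃ + t₄)
  identity₂ = solve-∀
  σ₀ σ₁ σ₂ : ℕ
  σ₀ = 25 * 1 + t₂ * 1 + t₃ * 1 + t₄ * 1 + t₅ * 1 + t₆ * 1
  σ₁ = 25 * 1 + t₂ * 2 + t₃ * 3 + t₄ * 4 + t₅ * 5 + t₆ * 6
  σ₂ = 25 * 1 + t₂ * 4 + t₃ * 9 + t₄ * 16 + t₅ * 25 + t₆ * 36
  weights₂₃ : 5 * 300 + 2 * (25 + (t₄ + (t₅ + 2 * t₆) * 3)) ≡ 900 + 6 * 133
  weights₂₃ = begin-equality
    5 * 300 + 2 * (25 + (t₄ + (t₅ + 2 * t₆) * 3))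
      ≡⟨ cong (λ s → 5 * s + 2 * (25 + (t₄ + (t₅ + 2 * t₆) * 3))) {σ₁} {300} σ₁≡300 ⟨
    5 * σ₁ + 2 * (25 + (t₄ + (t₅ + 2 * t₆) * 3))
      ≡⟨ identity₁ 25 t₂ t₃ t₄ t₅ t₆ ⟩
    σ₂ + 6 * σ₀
      ≡⟨ cong₂ (λ a b → a + 6 * b) {σ₂} {900} {σ₀} {133} σ₂≡900 σ₀≡133 ⟩
    900 + 6 * 133
      ∎
  weights₂₅ : 7 * 300 + 4 * 25 + 4 * t₆ ≡ 900 + 10 * 133 + 2 * (t₃ + t₄)
  weights₂₅ = begin-equality
    7 * 300 + 4 * 25 + 4 * t₆
      ≡⟨ cong (λ s → 7 * s + 4 * 25 + 4 * t₆) {σ₁} {300} σ₁≡300 ⟨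
    7 * σ₁ + 4 * 25 + 4 * t₆
      ≡⟨ identity₂ 25 t₂ t₃ t₄ t₅ t₆ ⟩
    σ₂ + 10 * σ₀ + 2 * (t₃ + t₄)
      ≡⟨ cong₂ (λ a b → a + 10 * b + 2 * (t₃ + t₄)) {σ₂} {900} {σ₀} {133} σ₂≡900 σ₀≡133 ⟩
    900 + 10 * 133 + 2 * (t₃ + t₄)
      ∎
  t₄+3[t₅+2t₆]≡74 : t₄ + (t₅ + 2 * t₆) * 3 ≡ 74
  t₄+3[t₅+2t₆]≡74 = +-cancelˡ-≡ 25 _ 74 (*-cancelˡ-≡ _ 99 2 (+-cancelˡ-≡ 1500 _ 198 weights₂₃))
  2≤t₄ : 2 ≤ t₄
  2≤t₄ = subst (_≤ t₄) (trans (sym ([m+kn]%n≡m%n t₄ (t₅ + 2 * t₆) 3)) (cong (_% 3) t₄+3[t₅+2t₆]≡74)) (m%n≤m t₄ 3)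

drop-zeroth : ∀ a₀ a₁ a₂ a₃ a₄ a₅ a₆ → a₀ ≡ 0 →
              a₀ + (a₁ + (a₂ + (a₃ + (a₄ + (a₅ + (a₆ + 0)))))) ≡ a₁ + a₂ + a₃ + a₄ + a₅ + a₆
drop-zeroth .0 a₁ a₂ a₃ a₄ a₅ a₆ refl = solve (a₁ ∷ a₂ ∷ a₃ ∷ a₄ ∷ a₅ ∷ a₆ ∷ [])

-- Blocking semiovals of size 25 in PG(2,11)

module BlockingSemiovalOfSize25
  (S : PointSet) (blocking : ∀ L → 1 ≤ meet S L) (semioval : IsSemioval S)
  (|S|≡25 : size S ≡ 25) (no-10-secant : ∀ L → ¬ (meet S L ≡ 10)) where

  open Pencils PG[2,11]
  open PointSets PG[2,11]
  open BlockingSemioval S blocking semioval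

  t : ℕ → ℕ
  t j = secants j S

  secantsAt₆≤3 : ∀ P → S P ≡ true → secantsThrough 6 S P ≤ 3
  secantsAt₆≤3 P P∈S =
    24+4x≤37⇒x≤3 _ (subst (λ s → 24 + 4 * secantsAt 6 S P ≤ s + 11 + 1) |S|≡25 (secantsAt-bound 6 P P∈S))

  long-meet≤6 : ∀ ℓ → 2 ≤ ∣ S ∩ ℓ ∣ → ∣ S ∩ ℓ ∣ ≤ 6
  long-meet≤6 ℓ 2≤∣S∩ℓ∣ = [ id , ⊥-elim ∘ no-10-secant ℓ ]′ (long-secant-arith u+k≡12 k+T≡25 T≤11u T≥)
    where
    u : ℕ
    u = ∣ (not ∘ S) ∩ ℓ ∣
    u+k≡12 : u + ∣ S ∩ ℓ ∣ ≡ 12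
    u+k≡12 = trans (+-comm u ∣ S ∩ ℓ ∣) (meet-+-meet-complement S ℓ)
    k+T≡25 : ∣ S ∩ ℓ ∣ + tangentsOff ℓ ≡ 25
    k+T≡25 = trans (meet-+-tangentsOff ℓ 2≤∣S∩ℓ∣) |S|≡25
    T≤11u : tangentsOff ℓ ≤ u * 11
    T≤11u = tangentsOff-≤ ℓ 2≤∣S∩ℓ∣
    T≥ : u * (24 + (∣ S ∩ ℓ ∣ ∸ 2)) ≤ u * 25 + tangentsOff ℓ
    T≥ = subst (λ s → u * (24 + (∣ S ∩ ℓ ∣ ∸ 2)) ≤ u * s + tangentsOff ℓ) |S|≡25 (tangentsOff-≥ ℓ)

  meet≤6 : ∀ L → meet S L ≤ 6
  meet≤6 ℓ with 2 ≤? ∣ S ∩ ℓ ∣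
  ... | yes 2≤∣S∩ℓ∣ = long-meet≤6 ℓ 2≤∣S∩ℓ∣
  ... | no ∣S∩ℓ∣≱2 = ≤-trans (≤-pred (≰⇒> ∣S∩ℓ∣≱2)) (s≤s z≤n)

  moment : (g : ℕ → ℕ) → ∑ᴸ (g ∘ ∣ S ∩_∣) ≡ t 1 * g 1 + t 2 * g 2 + t 3 * g 3 + t 4 * g 4 + t 5 * g 5 + t 6 * g 6
  moment g = trans (∑-by-value allLines ∣ S ∩_∣ g 7 (s≤s ∘ meet≤6))
                   (drop-zeroth (t 0 * g 0) (t 1 * g 1) (t 2 * g 2) (t 3 * g 3) (t 4 * g 4) (t 5 * g 5) (t 6 * g 6)
                                (cong (_* g 0) no-external-lines))
    where
    no-external-lines : t 0 ≡ 0
    no-external-lines = count-cong allLines (λ L → <⇒≡ᵇ-false (blocking L))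

  at-least-nine-6-secants : 9 ≤ t 6
  at-least-nine-6-secants = six-secants≥9 (t 1) (t 2) (t 3) (t 4) (t 5) (t 6) (trans tangents≡size |S|≡25)
    (trans (sym (moment (λ _ → 1))) line-count)
    (trans (sym (moment id)) ∑-meet≡300)
    (trans (sym (moment (λ n → n * n))) ∑-meet²≡900)
    where
    line-count : ∑ᴸ (λ _ → 1) ≡ 133
    line-count = refl
    ∑-meet≡300 : ∑ᴸ ∣ S ∩_∣ ≡ 300
    ∑-meet≡300 = trans (∑-meet S) (cong (_* 12) {size S} {25} |S|≡25)
    ∑-meet²≡900 : ∑ᴸ (λ L → ∣ S ∩ L ∣ * ∣ S ∩ L ∣) ≡ 900
    ∑-meet²≡900 = trans (∑-meet² S) (cong (λ s → s * (s + 11)) {size S} {25} |S|≡25)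

  at-least-four-points-on-three-6-secants : 4 ≤ count (λ P → S P ∧ (secantsThrough 6 S P ≡ᵇ 3)) allPoints
  at-least-four-points-on-three-6-secants = +-cancelˡ-≤ 50 4 N₃ (begin
    9 * 6                                   ≤⟨ *-monoˡ-≤ 6 at-least-nine-6-secants ⟩
    t 6 * 6                                 ≡⟨ ∑-secantsAt-over S 6 ⟨
    ∑ᴾ (λ P → ⟦ S P ⟧ * secantsAt 6 S P)    ≤⟨ ∑-≤-by-maxima allPoints S (secantsAt 6 S) 2 secantsAt₆≤3 ⟩
    size S * 2 + N₃                         ≡⟨ cong (λ s → s * 2 + N₃) {size S} {25} |S|≡25 ⟩
    50 + N₃                                 ∎)
    where
    open ≤-Reasoning
    N₃ : ℕ
    N₃ = count (λ P → S P ∧ (secantsThrough 6 S P ≡ᵇ 3)) allPoints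

proposition1 : (S : PointSet) → IsBlockingSemioval S → size S ≡ 25
    → (∀ L → ¬ (meet S L ≡ 10))
    → (∀ P → S P ≡ true → secantsThrough 6 S P ≤ 3)
      × (4 ≤ count (λ P → S P ∧ (secantsThrough 6 S P ≡ᵇ 3)) allPoints)
proposition1 S ((blocking , _) , semioval) |S|≡25 no-10-secant =
  secantsAt₆≤3 , at-least-four-points-on-three-6-secants
  where open BlockingSemiovalOfSize25 S blocking semioval |S|≡25 no-10-secant
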